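{- Let $k\ge2$ and let $m,n\ge k$ be natural numbers, written as $m=H_\alpha(k)+q$ and $n=H_\beta(k)+v$, where $\alpha$ (resp. $\beta$) is the largest element of $\{\gamma\in OT_0:\gamma<\Omega\}$ with $H_\alpha(k)\le m$ (resp. $H_\beta(k)\le n$), and $q=m-H_\alpha(k)$, $v=n-H_\beta(k)$. Then $m<n$ if and only if $\langle\alpha,q\rangle$ is lexicographically smaller than $\langle\beta,v\rangle$, i.e. $\alpha<\beta$, or $\alpha=\beta$ and $q<v$.
   Context: Ordinal terms. Let $T$ be the set of formal terms generated by: $0,1\in T$; if $\beta\in T$ then $\psi_0\beta,\psi_1\beta,\psi_2\beta\in T$ (these and $1$ are the principal terms); if $\alpha_0\ge\dots\ge\alpha_n$ ($n\ge1$) are principal terms then $\alpha_0+\dots+\alpha_n\in T$. The linear order $<$ on $T$ is generated by: $0<\alpha$ for $\alpha\ne0$; $1<\psi_i\beta$; $\psi_i\alpha<\psi_i\beta$ if $\alpha<\beta$; $\psi_i\alpha<\psi_j\beta$ if $i<j$; sums (a principal term counting as a sum of length one) are compared lexicographically. Abbreviations: $\omega:=\psi_00$, $\Omega:=\psi_10$, $\Omega_2:=\psi_20$; a natural number $n$ is identified with $1+\dots+1$; $\alpha\cdot x$ is the $x$-fold sum. For a set $A$ of terms, $A<\beta$ means every element of $A$ is $<\beta$. Sets $G_0,G_1$: $G_1\alpha=\emptyset$ if $\alpha<\Omega$; $G_1\psi_2\beta=G_1\beta$; $G_1$ of a sum is the union over summands; $G_1\psi_1\beta=\{\beta\}\cup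 G_1\beta$; $G_1\psi_0\beta=\emptyset$. $G_00=G_01=\emptyset$; $G_0\psi_2\beta=G_0\beta$; $G_0$ of a sum is the union; $G_0\psi_1\beta=G_0\beta$; $G_0\psi_0\beta=\{\beta\}\cup G_0\beta$. $OT\subseteq T$: $0,1\in OT$; $\psi_2\beta\in OT$ if $\beta\in OT$; a sum is in $OT$ if all summands are; $\psi_1\beta\in OT$ if $\beta\in OT$ and $G_1\beta<\beta$; $\psi_0\beta\in OT$ if $\beta\in OT$, $G_0\beta<\beta$, $\beta<\Omega_2$. $\varepsilon_{\Omega+1}$ denotes $\psi_1\Omega_2$, and $OT_0:=\{\alpha\in OT:\alpha<\varepsilon_{\Omega+1},\ G_0\alpha<\varepsilon_{\Omega+1}\}$. Fundamental sequences: $tp(0)=0$; $tp(1)=1$, $1[0]=0$; for $\Omega_0:=\omega,\Omega_1:=\Omega,\Omega_2$: $tp(\Omega_i)=\Omega_i$, $\Omega_i[x]=x$; for a sum $\alpha_0+\dots+\alpha_n$ ($n\ge1$): $tp=tp(\alpha_n)$, $(\alpha_0+\dots+\alpha_n)[x]=\alpha_0+\dots+\alpha_{n-1}+\alpha_n[x]$; if $tp(\alpha)=1$: $tp(\psi_i\alpha)=\omega$, $(\psi_i\alpha)[x]=\psi_i(\alpha[0])\cdot x$; if $tp(\alpha)\notin\{0,1\}$ and ($i=2$ or $tp(\alpha)<\Omega_{i+1}$): $tp(\psi_i\alpha)=tp(\alpha)$, $(\psi_i\alpha)[x]=\psi_i(\alpha[x])$; if $tp(\alpha)=\Omega$: $tp(\psi_0\alpha)=\omega$,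 $(\psi_0\alpha)[x]=\psi_0(\alpha[z_x])$, $z_0=0$, $z_{x+1}=\psi_0(\alpha[z_x])$; if $tp(\alpha)=\Omega_2$: $tp(\psi_1\alpha)=\omega$, $(\psi_1\alpha)[x]=\psi_1(\alpha[z_x])$, $z_0=0$, $z_{x+1}=\psi_1(\alpha[z_x])$. Conventions: $0[x]=0$, $(\alpha+1)[x]=\alpha$, if $tp(\alpha)\in\{0,1\}$ then $\alpha[m]=\alpha[0]$. Hardy hierarchy. For $k\ge1$ and $\alpha\in OT_0$, $\alpha<\Omega$: $H_0(k)=k$; $H_{\alpha+1}(k)=H_\alpha(k)\cdot k$; if $tp(\lambda)=\omega$, $H_\lambda(k)=H_{\lambda\{k\}}(k)$ with $\lambda\{0\}=\lambda[0]$, $\lambda\{b+1\}=\lambda[H_{\lambda\{b\}}(k)]$. -}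

module Defs where

open import Data.Nat using (ℕ; zero; suc; _*_)
open import Data.Fin using (Fin; zero; suc)
open import Data.List using (List; []; _∷_; _++_; replicate; length)
open import Data.List.Relation.Unary.All using (All)
open import Data.Product using (_×_)
open import Data.Sum using (_⊎_)
open import Data.Unit using (⊤)
open import Relation.Binary.PropositionalEquality using (_≡_)

-- A term of T is represented by the list of its principal summands:
--   0 = [],  a principal term p = [ p ],  α₀+…+αₙ (n ≥ 1) = α₀ ∷ … ∷ αₙ ∷ [].
-- The condition α₀ ≥ … ≥ αₙ is imposed by the predicate Desc (part of OT).

mutual
  data P : Set where
    one : P
    ψ   : Fin 3 → List P → P

Tm : Set
Tm = List P

𝟘 𝟙 ω Ω Ω₂ εΩ+1 : Tm
𝟘 = []
𝟙 = one ∷ []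
ω = ψ zero [] ∷ []
Ω = ψ (suc zero) [] ∷ []
Ω₂ = ψ (suc (suc zero)) [] ∷ []
εΩ+1 = ψ (suc zero) Ω₂ ∷ []

nat : ℕ → Tm
nat n = replicate n one

data Cmp : Set where
  LT EQ GT : Cmp

thenCmp : Cmp → Cmp → Cmp
thenCmp EQ d = d
thenCmp c  _ = c

cmpFin : ∀ {n} → Fin n → Fin n → Cmp
cmpFin zero zero = EQ
cmpFin zero (suc _) = LT
cmpFin (suc _) zero = GT
cmpFin (suc i) (suc j) = cmpFin i j

mutual
  cmpL : Tm → Tm → Cmp
  cmpL [] [] = EQ
  cmpL [] (_ ∷ _) = LT
  cmpL (_ ∷ _) [] = GT
  cmpL (p ∷ ps) (q ∷ qs) = thenCmp (cmpP p q) (cmpL ps qs)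

  cmpP : P → P → Cmp
  cmpP one one = EQ
  cmpP one (ψ _ _) = LT
  cmpP (ψ _ _) one = GT
  cmpP (ψ i a) (ψ j b) = thenCmp (cmpFin i j) (cmpL a b)

infix 4 _<T_ _≤T_
_<T_ : Tm → Tm → Set
α <T β = cmpL α β ≡ LT

_≤T_ : Tm → Tm → Set
α ≤T β = α <T β ⊎ α ≡ β

mutual
  G₁ : Tm → List Tm
  G₁ [] = []
  G₁ (p ∷ ps) = G₁P p ++ G₁ ps

  G₁P : P → List Tm
  G₁P one = []
  G₁P (ψ zero b) = []
  G₁P (ψ (suc zero) b) = b ∷ G₁ b
  G₁P (ψ (suc (suc zero)) b) = G₁ b

mutual
  G₀ : Tm → List Tm
  G₀ [] = []
  G₀ (p ∷ ps) = G₀P p ++ G₀ ps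

  G₀P : P → List Tm
  G₀P one = []
  G₀P (ψ zero b) = b ∷ G₀ b
  G₀P (ψ (suc zero) b) = G₀ b
  G₀P (ψ (suc (suc zero)) b) = G₀ b

_<Set_ : List Tm → Tm → Set
A <Set β = All (_<T β) A

Desc : Tm → Set
Desc [] = ⊤
Desc (p ∷ []) = ⊤
Desc (p ∷ q ∷ r) = (q ∷ []) ≤T (p ∷ []) × Desc (q ∷ r)

mutual
  OT : Tm → Set
  OT [] = ⊤
  OT (p ∷ ps) = OTP p × OTall ps × Desc (p ∷ ps)

  OTall : Tm → Set
  OTall [] = ⊤
  OTall (p ∷ ps) = OTP p × OTall ps

  OTP : P → Set
  OTP one = ⊤
  OTP (ψ zero b) = OT b × G₀ b <Set b × b <T Ω₂
  OTP (ψ (suc zero) b) = OT b × G₁ b <Set b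
  OTP (ψ (suc (suc zero)) b) = OT b

OT₀ : Tm → Set
OT₀ α = OT α × α <T εΩ+1 × G₀ α <Set εΩ+1

-- possible values of tp: 0, 1, Ω₀ = ω, Ω₁ = Ω, Ω₂
data Tp : Set where
  tp0 tp1 : Tp
  tpΩ : Fin 3 → Tp

tpψ : Fin 3 → Tp → Tp
tpψ i tp0 = tpΩ i
tpψ i tp1 = tpΩ zero
tpψ (suc (suc zero)) (tpΩ j) = tpΩ j
tpψ (suc zero) (tpΩ zero) = tpΩ zero
tpψ (suc zero) (tpΩ (suc zero)) = tpΩ (suc zero)
tpψ (suc zero) (tpΩ (suc (suc zero))) = tpΩ zero
tpψ zero (tpΩ zero) = tpΩ zero
tpψ zero (tpΩ (suc zero)) = tpΩ zero
tpψ zero (tpΩ (suc (suc zero))) = tpΩ zero   -- case not covered by the paper (junk)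

mutual
  tp : Tm → Tp
  tp [] = tp0
  tp (p ∷ []) = tpP p
  tp (p ∷ q ∷ r) = tp (q ∷ r)

  tpP : P → Tp
  tpP one = tp1
  tpP (ψ i α) = tpψ i (tp α)

-- α[x]; where x must be a natural number it is read off as the number
-- of summands of the term x (x = 1+…+1).
mutual
  fs : Tm → Tm → Tm
  fs [] x = []
  fs (p ∷ []) x = fsP p x
  fs (p ∷ q ∷ r) x = p ∷ fs (q ∷ r) x

  fsP : P → Tm → Tm
  fsP one x = []
  fsP (ψ i α) x = fsψ i α (tp α) x

  fsψ : Fin 3 → Tm → Tp → Tm → Tm
  fsψ i α tp0 x = x
  fsψ i α tp1 x = replicate (length x) (ψ i (fs α []))
  fsψ (suc (suc zero)) α (tpΩ j) x = ψ (suc (suc zero)) (fs α x) ∷ []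
  fsψ (suc zero) α (tpΩ zero) x = ψ (suc zero) (fs α x) ∷ []
  fsψ (suc zero) α (tpΩ (suc zero)) x = ψ (suc zero) (fs α x) ∷ []
  fsψ (suc zero) α (tpΩ (suc (suc zero))) x =
    ψ (suc zero) (fs α (zseq (suc zero) α (length x))) ∷ []
  fsψ zero α (tpΩ zero) x = ψ zero (fs α x) ∷ []
  fsψ zero α (tpΩ (suc zero)) x = ψ zero (fs α (zseq zero α (length x))) ∷ []
  fsψ zero α (tpΩ (suc (suc zero))) x = []   -- case not covered by the paper (junk)

  zseq : Fin 3 → Tm → ℕ → Tm
  zseq i α zero = []
  zseq i α (suc n) = ψ i (fs α (zseq i α n)) ∷ []

-- Hardy hierarchy, as the graph of its defining recursion:
-- Hardy k α r  means  H_α(k) = r;  Brace k λ b μ  means  λ{b} = μ.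

mutual
  data Hardy (k : ℕ) : Tm → ℕ → Set where
    H-zero : Hardy k [] k
    H-suc  : ∀ {α r} → Hardy k α r → Hardy k (α ++ one ∷ []) (r * k)
    H-lim  : ∀ {λ' μ r} → tp λ' ≡ tpΩ zero → Brace k λ' k μ → Hardy k μ r →
             Hardy k λ' r

  data Brace (k : ℕ) (λ' : Tm) : ℕ → Tm → Set where
    B-zero : Brace k λ' zero (fs λ' [])
    B-suc  : ∀ {b μ r} → Brace k λ' b μ → Hardy k μ r →
             Brace k λ' (suc b) (fs λ' (nat r))

IsLargestBelow : ℕ → ℕ → Tm → ℕ → Set
IsLargestBelow k m α h =
  OT₀ α × α <T Ω × Hardy k α h × h Data.Nat.≤ m ×
  (∀ γ r → OT₀ γ → γ <T Ω → Hardy k γ r → r Data.Nat.≤ m → γ ≤T α)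

-- If m ≤ n then H_α(k) ≤ m ≤ n, so α is a candidate for n and the maximality of β gives
-- α ≤ β. When α = β both decompositions subtract the same number H_α(k), because the
-- Hardy recursion has at most one value, and m < n becomes q < v. Conversely, n ≤ m
-- gives β ≤ α, which rules out α < β, and with α = β it gives v ≤ q.
module Submission where

open import Defs
open import Data.Nat using (ℕ; _≤_; _<_; _∸_; _*_)
open import Data.Nat.Properties using (<⇒≤; ≤-trans; ≰⇒>; <⇒≱; ∸-monoˡ-<; ∸-monoˡ-≤)
open import Data.Fin using (Fin; zero; suc)
open import Data.List using ([]; _∷_; _++_)
open import Data.List.Properties using (++-cancelʳ)
open import Data.Sum using (_⊎_; inj₁; inj₂)
open import Data.Product using (_×_; _,_)
open import Data.Empty using (⊥-elim)
open import Relation.Nullary using (¬_)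
open import Relation.Binary.PropositionalEquality using (_≡_; refl; cong; sym; trans)
open import Function.Bundles using (_⇔_; mk⇔)

flipCmp : Cmp → Cmp
flipCmp LT = GT
flipCmp EQ = EQ
flipCmp GT = LT

flipCmp-thenCmp : ∀ c d → flipCmp (thenCmp c d) ≡ thenCmp (flipCmp c) (flipCmp d)
flipCmp-thenCmp LT d = refl
flipCmp-thenCmp EQ d = refl
flipCmp-thenCmp GT d = refl

cmpFin-swap : ∀ {n} (i j : Fin n) → cmpFin j i ≡ flipCmp (cmpFin i j)
cmpFin-swap zero    zero    = refl
cmpFin-swap zero    (suc j) = refl
cmpFin-swap (suc i) zero    = refl
cmpFin-swap (suc i) (suc j) = cmpFin-swap i j

cmpFin-refl : ∀ {n} (i : Fin n) → cmpFin i i ≡ EQ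
cmpFin-refl zero    = refl
cmpFin-refl (suc i) = cmpFin-refl i

mutual
  cmpL-swap : ∀ α β → cmpL β α ≡ flipCmp (cmpL α β)
  cmpL-swap []       []       = refl
  cmpL-swap []       (_ ∷ _)  = refl
  cmpL-swap (_ ∷ _)  []       = refl
  cmpL-swap (p ∷ ps) (q ∷ qs) rewrite cmpP-swap p q | cmpL-swap ps qs =
    sym (flipCmp-thenCmp (cmpP p q) (cmpL ps qs))

  cmpP-swap : ∀ p q → cmpP q p ≡ flipCmp (cmpP p q)
  cmpP-swap one     one     = refl
  cmpP-swap one     (ψ _ _) = refl
  cmpP-swap (ψ _ _) one     = refl
  cmpP-swap (ψ i α) (ψ j β) rewrite cmpFin-swap i j | cmpL-swap α β =
    sym (flipCmp-thenCmp (cmpFin i j) (cmpL α β))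

mutual
  cmpL-refl : ∀ α → cmpL α α ≡ EQ
  cmpL-refl []       = refl
  cmpL-refl (p ∷ ps) rewrite cmpP-refl p = cmpL-refl ps

  cmpP-refl : ∀ p → cmpP p p ≡ EQ
  cmpP-refl one     = refl
  cmpP-refl (ψ i α) rewrite cmpFin-refl i = cmpL-refl α

<T-irrefl : ∀ {α} → ¬ α <T α
<T-irrefl {α} α<α with () ← trans (sym α<α) (cmpL-refl α)

<T-asym : ∀ {α β} → α <T β → ¬ β <T α
<T-asym {α} {β} α<β β<α with () ← trans (sym β<α) (trans (cmpL-swap α β) (cong flipCmp α<β))

<T⇒≱T : ∀ {α β} → α <T β → ¬ β ≤T α
<T⇒≱T {α} {β} α<β (inj₁ β<α) = <T-asym {α} {β} α<β β<α
<T⇒≱T {α} α<β (inj₂ refl) = <T-irrefl {α} α<β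

tp-+1 : ∀ α → tp (α ++ one ∷ []) ≡ tp1
tp-+1 []          = refl
tp-+1 (_ ∷ [])    = refl
tp-+1 (_ ∷ β ∷ γ) = tp-+1 (β ∷ γ)

+1≢0 : ∀ α → ¬ α ++ one ∷ [] ≡ []
+1≢0 [] ()
+1≢0 (_ ∷ _) ()

-- α ++ one ∷ [] is not a constructor pattern, so the equality of the indices is an argument.
mutual
  Hardy-functional′ : ∀ {k α β r s} → Hardy k α r → Hardy k β s → α ≡ β → r ≡ s
  Hardy-functional′ H-zero          H-zero          _     = refl
  Hardy-functional′ H-zero          (H-suc {α} _)   α+1≡0 = ⊥-elim (+1≢0 α (sym α+1≡0))
  Hardy-functional′ (H-suc {α} _)   H-zero          α+1≡0 = ⊥-elim (+1≢0 α α+1≡0)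
  Hardy-functional′ (H-suc {α} Hα)  (H-suc {β} Hβ)  α+1≡β+1 =
    cong (_* _) (Hardy-functional′ Hα Hβ (++-cancelʳ (one ∷ []) α β α+1≡β+1))
  Hardy-functional′ H-zero          (H-lim () _ _)  refl
  Hardy-functional′ (H-lim () _ _)  H-zero          refl
  Hardy-functional′ (H-suc {α} _)   (H-lim lim _ _) refl with () ← trans (sym (tp-+1 α)) lim
  Hardy-functional′ (H-lim lim _ _) (H-suc {α} _)   refl with () ← trans (sym (tp-+1 α)) lim
  Hardy-functional′ (H-lim _ bμ Hμ) (H-lim _ bν Hν) refl =
    Hardy-functional′ Hμ Hν (Brace-functional bμ bν)

  Brace-functional : ∀ {k λ' b μ ν} → Brace k λ' b μ → Brace k λ' b ν → μ ≡ ν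
  Brace-functional B-zero B-zero = refl
  Brace-functional {λ' = λ'} (B-suc bμ Hμ) (B-suc bν Hν) =
    cong (λ r → fs λ' (nat r)) (Hardy-functional′ Hμ Hν (Brace-functional bμ bν))

Hardy-functional : ∀ {k α r s} → Hardy k α r → Hardy k α s → r ≡ s
Hardy-functional Hr Hs = Hardy-functional′ Hr Hs refl

largestBelow-mono : ∀ {k m n α β hα hβ} →
  IsLargestBelow k m α hα → IsLargestBelow k n β hβ → m ≤ n → α ≤T β
largestBelow-mono (OT₀α , α<Ω , Hα , hα≤m , _) (_ , _ , _ , _ , β-max) m≤n =
  β-max _ _ OT₀α α<Ω Hα (≤-trans hα≤m m≤n)

largestBelow-value : ∀ {k m n α hα hα′} →
  IsLargestBelow k m α hα → IsLargestBelow k n α hα′ → hα ≡ hα′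
largestBelow-value (_ , _ , Hα , _) (_ , _ , Hα′ , _) = Hardy-functional Hα Hα′

-- The bounds on k, m and n only serve, in the paper, to make α and β exist.
mainTheorem13 : ∀ (k m n : ℕ) → 2 ≤ k → k ≤ m → k ≤ n →
    ∀ (α β : Tm) (hα hβ : ℕ) →
    IsLargestBelow k m α hα → IsLargestBelow k n β hβ →
    (m < n) ⇔ (α <T β ⊎ (α ≡ β × (m ∸ hα) < (n ∸ hβ)))
mainTheorem13 k m n _ _ _ α β hα hβ α-max@(_ , _ , _ , hα≤m , _) β-max = mk⇔ to from
  where
  to : m < n → α <T β ⊎ (α ≡ β × (m ∸ hα) < (n ∸ hβ))
  to m<n with largestBelow-mono α-max β-max (<⇒≤ m<n)
  ... | inj₁ α<β = inj₁ α<β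
  ... | inj₂ refl with refl ← largestBelow-value α-max β-max =
    inj₂ (refl , ∸-monoˡ-< m<n hα≤m)

  from : α <T β ⊎ (α ≡ β × (m ∸ hα) < (n ∸ hβ)) → m < n
  from (inj₁ α<β) = ≰⇒> λ n≤m → <T⇒≱T {α} {β} α<β (largestBelow-mono β-max α-max n≤m)
  from (inj₂ (refl , q<v)) with refl ← largestBelow-value α-max β-max =
    ≰⇒> λ n≤m → <⇒≱ q<v (∸-monoˡ-≤ hα n≤m)
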